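{- Let $p$ be a prime and let $\zeta\in\mathbb{Z}_p\setminus\mathbb{N}$. If there exist real numbers $C,D$ such that $C>0$, $D\ge-(C+1)$, and $\ell_\zeta(a)\le Ca+D$ for all $a\ge2$, then $$\nu_p(n-\zeta)\le\frac{2C+D+2}{\log(p)}\log(n)$$ for all integers $n\ge p$.
   Context: $\mathbb{Z}_p$ is the ring of $p$-adic integers and $\nu_p$ the $p$-adic valuation on $\mathbb{Z}_p$; $\log$ is the real natural logarithm. Write $\zeta=\sum_{i\ge0}d_ip^i$ with each $d_i\in\{0,1,\ldots,p-1\}$. For each $a\ge0$, $\ell_\zeta(a)\ge0$ is the maximal integer such that $0=d_a=d_{a+1}=\cdots=d_{a+\ell_\zeta(a)-1}$ (the length of the block of zero digits starting at position $a$).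
   Formalization: The constants C and D are rational numbers rather than real numbers. -}

module Defs where

open import Data.Nat as ℕ using (ℕ; zero; suc; _^_)
open import Data.Fin using (Fin; toℕ)
open import Data.Integer as ℤ using (ℤ; +_; ∣_∣)
open import Data.Integer.Divisibility using () renaming (_∣_ to _∣ℤ_)
open import Data.Rational as ℚ using (ℚ; ↥_; ↧ₙ_)

-- A p-adic integer ζ ∈ ℤ_p is given by its digit sequence (d_i), ζ = Σ d_i p^i.
Digits : ℕ → Set
Digits p = ℕ → Fin p

trunc : (p : ℕ) → Digits p → ℕ → ℕ
trunc p d zero    = 0
trunc p d (suc k) = trunc p d k ℕ.+ toℕ (d k) ℕ.* p ^ k

-- ζ ∈ ℕ  iff its digit sequence is eventually zero
InNat : (p : ℕ) → Digits p → Set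
InNat p d = Σ ℕ λ N → ∀ i → N ℕ.≤ i → toℕ (d i) ≡ 0
  where open import Data.Product using (Σ)
        open import Relation.Binary.PropositionalEquality using (_≡_)

-- p^k divides (n - ζ) in ℤ_p  iff  n ≡ ζ (mod p^k)  iff  p^k ∣ n - (ζ mod p^k)
PowDividesDiff : (p : ℕ) → Digits p → (k n : ℕ) → Set
PowDividesDiff p d k n = (+ (p ^ k)) ∣ℤ ((+ n) ℤ.- (+ trunc p d k))

-- ℓ_ζ(a) ≤ x, unfolded: every block of zero digits starting at position a
-- has length ≤ x (ℓ_ζ(a) is the maximal such length)
ZeroBlockLenLe : (p : ℕ) → Digits p → ℕ → ℚ → Set
ZeroBlockLenLe p d a x =
  ∀ m → (∀ i → i ℕ.< m → toℕ (d (a ℕ.+ i)) ≡ 0) → (+ m ℚ./ 1) ℚ.≤ x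
  where open import Relation.Binary.PropositionalEquality using (_≡_)

ℚ[_] : ℕ → ℚ
ℚ[ n ] = + n ℚ./ 1

-- For K = u/v (lowest terms, v > 0) with u ≥ 0:
--   k * log p ≤ K * log n   ⇔   p^(k v) ≤ n^u
LogBound : (p k n : ℕ) → ℚ → Set
LogBound p k n K = p ^ (k ℕ.* ↧ₙ K) ℕ.≤ n ^ ∣ ↥ K ∣

{-# OPTIONS --safe #-}
-- Let e = ⌊log_p n⌋, so p ≤ n gives e ≥ 1. If p^k ∣ n − ζ, the first k digits of ζ are
-- those of n < p^(e+1), so the digits of ζ at positions e+1, …, k−1 vanish: a zero block
-- at position e+1 of length k ∸ (e+1) (empty when k ≤ e+1, in which case the hypothesis
-- still yields 0 ≤ C(e+1) + D). Hence k ≤ (e+1) + C(e+1) + D ≤ (2C+D+2)e, the slack being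
-- (C+D+1)(e−1) ≥ 0, and together with p^e ≤ n this is k log p ≤ (2C+D+2) log n.
module Submission where

open import Defs
open import Data.Nat using (ℕ; _≤_)
open import Data.Nat.Primality using (Prime)
open import Data.Rational using (ℚ; _+_; _*_; -_; 0ℚ; 1ℚ) renaming (_≤_ to _≤ℚ_; _<_ to _<ℚ_)
open import Relation.Nullary using (¬_)

open import Data.Nat as ℕ using (zero; suc; _^_; _<_; _∸_; NonZero; s≤s; z≤n)
import Data.Nat.Properties as ℕₚ
open import Data.Nat.Divisibility as ℕᵈ using (>⇒∤)
open import Data.Nat.Primality using (prime⇒nonZero; prime⇒nonTrivial)
open import Data.Nat.Coprimality using (1-coprimeTo) renaming (sym to coprime-sym)
open import Data.Fin using (toℕ)
open import Data.Fin.Properties using (toℕ<n)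
open import Data.Integer as ℤ using (+_; ∣_∣)
import Data.Integer.Properties as ℤₚ
open import Data.Integer.Divisibility using () renaming (_∣_ to _∣ℤ_)
open import Data.Rational using (mkℚ; ↥_; ↧ₙ_; toℚᵘ; _-_; nonNegative)
import Data.Rational.Properties as ℚₚ
open import Data.Rational.Unnormalised as ℚᵘ using (mkℚᵘ; *≡*; *≤*)
import Data.Rational.Unnormalised.Properties as ℚᵘₚ
open import Data.Rational.Solver using (module +-*-Solver)
open import Data.Product using (∃-syntax; _×_; _,_)
open import Data.Sum using (inj₁; inj₂)
open import Relation.Nullary using (contradiction)
open import Relation.Binary.PropositionalEquality

toℚᵘ-ℚ[] : ∀ n → toℚᵘ ℚ[ n ] ≡ mkℚᵘ (+ n) 0
toℚᵘ-ℚ[] n = cong toℚᵘ (ℚₚ.normalize-coprime (coprime-sym (1-coprimeTo n)))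

ℚ[]-homo-+ : ∀ m n → ℚ[ m ℕ.+ n ] ≡ ℚ[ m ] + ℚ[ n ]
ℚ[]-homo-+ m n = ℚₚ.toℚᵘ-injective (begin
  toℚᵘ ℚ[ m ℕ.+ n ]                ≡⟨ toℚᵘ-ℚ[] (m ℕ.+ n) ⟩
  mkℚᵘ (+ (m ℕ.+ n)) 0            ≈⟨ *≡* num ⟩
  mkℚᵘ (+ m) 0 ℚᵘ.+ mkℚᵘ (+ n) 0  ≡⟨ cong₂ ℚᵘ._+_ (toℚᵘ-ℚ[] m) (toℚᵘ-ℚ[] n) ⟨
  toℚᵘ ℚ[ m ] ℚᵘ.+ toℚᵘ ℚ[ n ]     ≈⟨ ℚₚ.toℚᵘ-homo-+ ℚ[ m ] ℚ[ n ] ⟨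
  toℚᵘ (ℚ[ m ] + ℚ[ n ])           ∎)
  where
  open ℚᵘₚ.≃-Reasoning
  num : + (m ℕ.+ n) ℤ.* + 1 ≡ (+ m ℤ.* + 1 ℤ.+ + n ℤ.* + 1) ℤ.* + 1
  num = trans (ℤₚ.*-identityʳ _)
    (sym (trans (ℤₚ.*-identityʳ _) (cong₂ ℤ._+_ (ℤₚ.*-identityʳ (+ m)) (ℤₚ.*-identityʳ (+ n)))))

ℚ[]-mono-≤ : ∀ {m n} → m ≤ n → ℚ[ m ] ≤ℚ ℚ[ n ]
ℚ[]-mono-≤ {m} {n} m≤n = ℚₚ.toℚᵘ-cancel-≤
  (subst₂ ℚᵘ._≤_ (sym (toℚᵘ-ℚ[] m)) (sym (toℚᵘ-ℚ[] n))
    (*≤* (subst₂ ℤ._≤_ (sym (ℤₚ.*-identityʳ (+ m))) (sym (ℤₚ.*-identityʳ (+ n))) (ℤ.+≤+ m≤n))))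

+m≤i⇒m≤∣i∣ : ∀ {m i} → + m ℤ.≤ i → m ≤ ∣ i ∣
+m≤i⇒m≤∣i∣ (ℤ.+≤+ m≤n) = m≤n

ℚ[k]≤q*ℚ[e]⇒k*↧q≤∣↥q∣*e : ∀ {k e} q → ℚ[ k ] ≤ℚ q * ℚ[ e ] → k ℕ.* ↧ₙ q ≤ ∣ ↥ q ∣ ℕ.* e
ℚ[k]≤q*ℚ[e]⇒k*↧q≤∣↥q∣*e {k} {e} q@(mkℚ u v _) k≤qe =
  subst₂ _≤_ (cong (k ℕ.*_) (ℕₚ.*-identityʳ (suc v))) (ℤₚ.abs-* u (+ e))
    (+m≤i⇒m≤∣i∣ (subst₂ ℤ._≤_ (sym (ℤₚ.pos-* k (suc v ℕ.* 1))) (ℤₚ.*-identityʳ (u ℤ.* + e))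
      (ℚᵘₚ.drop-*≤* unnormalised)))
  where
  unnormalised : mkℚᵘ (+ k) 0 ℚᵘ.≤ mkℚᵘ u v ℚᵘ.* mkℚᵘ (+ e) 0
  unnormalised = subst₂ (λ x y → x ℚᵘ.≤ toℚᵘ q ℚᵘ.* y) (toℚᵘ-ℚ[] k) (toℚᵘ-ℚ[] e)
    (ℚᵘₚ.≤-respʳ-≃ (ℚₚ.toℚᵘ-homo-* q ℚ[ e ]) (ℚₚ.toℚᵘ-mono-≤ k≤qe))

LogBound-intro : ∀ {p k n e} .{{_ : NonZero p}} K → p ^ e ≤ n → ℚ[ k ] ≤ℚ K * ℚ[ e ] → LogBound p k n K
LogBound-intro {p} {k} {n} {e} K pᵉ≤n k≤Ke = begin
  p ^ (k ℕ.* ↧ₙ K)        ≤⟨ ℕₚ.^-monoʳ-≤ p (ℚ[k]≤q*ℚ[e]⇒k*↧q≤∣↥q∣*e {k} {e} K k≤Ke) ⟩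
  p ^ (∣ ↥ K ∣ ℕ.* e)     ≡⟨ cong (p ^_) (ℕₚ.*-comm ∣ ↥ K ∣ e) ⟩
  p ^ (e ℕ.* ∣ ↥ K ∣)     ≡⟨ ℕₚ.^-*-assoc p e ∣ ↥ K ∣ ⟨
  (p ^ e) ^ ∣ ↥ K ∣       ≤⟨ ℕₚ.^-monoˡ-≤ ∣ ↥ K ∣ pᵉ≤n ⟩
  n ^ ∣ ↥ K ∣             ∎
  where open ℕₚ.≤-Reasoning

p≤q⇒0≤q-p : ∀ {p q} → p ≤ℚ q → 0ℚ ≤ℚ q - p
p≤q⇒0≤q-p {p} {q} p≤q = subst (_≤ℚ q - p) (ℚₚ.+-inverseʳ p) (ℚₚ.+-monoˡ-≤ (- p) p≤q)

0≤p⇒0≤q⇒0≤p*q : ∀ {p q} → 0ℚ ≤ℚ p → 0ℚ ≤ℚ q → 0ℚ ≤ℚ p * q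
0≤p⇒0≤q⇒0≤p*q {p} {q} 0≤p 0≤q = ℚₚ.nonNegative⁻¹ (p * q)
  {{ℚₚ.nonNeg*nonNeg⇒nonNeg p {{nonNegative 0≤p}} q {{nonNegative 0≤q}}}}

0≤q⇒p≤p+q : ∀ {p q} → 0ℚ ≤ℚ q → p ≤ℚ p + q
0≤q⇒p≤p+q {p} {q} 0≤q = subst (_≤ℚ p + q) (ℚₚ.+-identityʳ p) (ℚₚ.+-monoʳ-≤ p 0≤q)

ℓ≤C[1+e]+D⇒1+e+ℓ≤[2C+D+2]e : ∀ C D {e ℓ} → 1ℚ ≤ℚ e → - (C + 1ℚ) ≤ℚ D →
  ℓ ≤ℚ C * (1ℚ + e) + D → (1ℚ + e) + ℓ ≤ℚ (ℚ[ 2 ] * C + D + ℚ[ 2 ]) * e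
ℓ≤C[1+e]+D⇒1+e+ℓ≤[2C+D+2]e C D {e} {ℓ} 1≤e -[C+1]≤D ℓ≤ = begin
  (1ℚ + e) + ℓ                                                    ≤⟨ ℚₚ.+-monoʳ-≤ (1ℚ + e) ℓ≤ ⟩
  (1ℚ + e) + (C * (1ℚ + e) + D)                                   ≤⟨ 0≤q⇒p≤p+q slack ⟩
  (1ℚ + e) + (C * (1ℚ + e) + D) + (D - - (C + 1ℚ)) * (e - 1ℚ)    ≡⟨ identity C D e ⟩
  (ℚ[ 2 ] * C + D + ℚ[ 2 ]) * e                                   ∎
  where
  open ℚₚ.≤-Reasoning
  slack : 0ℚ ≤ℚ (D - - (C + 1ℚ)) * (e - 1ℚ)
  slack = 0≤p⇒0≤q⇒0≤p*q (p≤q⇒0≤q-p -[C+1]≤D) (p≤q⇒0≤q-p 1≤e)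
  identity : ∀ C D e → (1ℚ + e) + (C * (1ℚ + e) + D) + (D - - (C + 1ℚ)) * (e - 1ℚ)
                       ≡ (ℚ[ 2 ] * C + D + ℚ[ 2 ]) * e
  identity = solve 3 (λ C D e →
      (con 1ℚ :+ e) :+ (C :* (con 1ℚ :+ e) :+ D) :+ (D :- :- (C :+ con 1ℚ)) :* (e :- con 1ℚ)
    := (con ℚ[ 2 ] :* C :+ D :+ con ℚ[ 2 ]) :* e) refl
    where open +-*-Solver

m*n<n⇒m≡0 : ∀ {m n} → m ℕ.* n < n → m ≡ 0
m*n<n⇒m≡0 {zero}  _    = refl
m*n<n⇒m≡0 {suc m} {n} mn<n = contradiction (ℕₚ.m≤m+n n (m ℕ.* n)) (ℕₚ.<⇒≱ mn<n)

m∣n∧n<m⇒n≡0 : ∀ {m n} → m ℕᵈ.∣ n → n < m → n ≡ 0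
m∣n∧n<m⇒n≡0 {n = zero}  _   _   = refl
m∣n∧n<m⇒n≡0 {n = suc _} m∣n n<m = contradiction m∣n (>⇒∤ n<m)

P∣m-n∧m<P∧n<P⇒m≡n : ∀ {P m n} → + P ∣ℤ (+ m ℤ.- + n) → m < P → n < P → m ≡ n
P∣m-n∧m<P∧n<P⇒m≡n {P} {m} {n} P∣m-n m<P n<P =
  ℤₚ.+-injective (ℤₚ.i-j≡0⇒i≡j (+ m) (+ n) (ℤₚ.∣i∣≡0⇒i≡0 (m∣n∧n<m⇒n≡0 P∣m-n ∣m-n∣<P)))
  where
  ∣m-n∣<P : ∣ + m ℤ.- + n ∣ < P
  ∣m-n∣<P = subst (_< P) (cong ∣_∣ (sym (ℤₚ.m-n≡m⊖n m n)))
    (ℕₚ.≤-<-trans (ℤₚ.∣m⊝n∣≤m⊔n m n) (ℕₚ.⊔-pres-<m m<P n<P))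

∃-p^e≤n<p^[1+e] : ∀ {p} → 1 < p → ∀ n → 0 < n → ∃[ e ] p ^ e ≤ n × n < p ^ suc e
∃-p^e≤n<p^[1+e] {p} 1<p (suc zero) _ = 0 , ℕₚ.≤-refl , subst (1 <_) (sym (ℕₚ.*-identityʳ p)) 1<p
∃-p^e≤n<p^[1+e] {p} 1<p (suc (suc n)) _ with ∃-p^e≤n<p^[1+e] 1<p (suc n) (s≤s z≤n)
... | e , pᵉ≤1+n , 1+n<pᵉ⁺¹ with ℕₚ.m≤n⇒m<n∨m≡n 1+n<pᵉ⁺¹
...   | inj₁ 2+n<pᵉ⁺¹ = e , ℕₚ.m≤n⇒m≤1+n pᵉ≤1+n , 2+n<pᵉ⁺¹
...   | inj₂ 2+n≡pᵉ⁺¹ = suc e , ℕₚ.≤-reflexive (sym 2+n≡pᵉ⁺¹) ,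
        subst (λ x → suc (suc n) < p ℕ.* x) 2+n≡pᵉ⁺¹
          (subst (suc (suc n) <_) (ℕₚ.*-comm _ p) (ℕₚ.m<m*n (suc (suc n)) p 1<p))

p≤n<p^[1+e]⇒1≤e : ∀ {p n e} → p ≤ n → n < p ^ suc e → 1 ≤ e
p≤n<p^[1+e]⇒1≤e {e = suc _} _   _       = s≤s z≤n
p≤n<p^[1+e]⇒1≤e {p} {n} {zero} p≤n n<p¹ =
  contradiction (subst (n <_) (ℕₚ.*-identityʳ p) n<p¹) (ℕₚ.≤⇒≯ p≤n)

module _ {p : ℕ} .{{_ : NonZero p}} (d : Digits p) where

  trunc-< : ∀ k → trunc p d k < p ^ k
  trunc-< zero    = s≤s z≤n
  trunc-< (suc k) = ℕₚ.≤-trans (ℕₚ.+-monoˡ-< (toℕ (d k) ℕ.* p ^ k) (trunc-< k))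
    (ℕₚ.*-monoˡ-≤ (p ^ k) (toℕ<n (d k)))

  digit*p^i≤trunc : ∀ {i k} → i < k → toℕ (d i) ℕ.* p ^ i ≤ trunc p d k
  digit*p^i≤trunc {i} {suc k} i<1+k with ℕₚ.m<1+n⇒m<n∨m≡n i<1+k
  ... | inj₁ i<k  = ℕₚ.≤-trans (digit*p^i≤trunc i<k) (ℕₚ.m≤m+n _ _)
  ... | inj₂ refl = ℕₚ.m≤n+m _ _

  trunc≡n∧n<p^i⇒digit≡0 : ∀ {i k n} → trunc p d k ≡ n → n < p ^ i → i < k → toℕ (d i) ≡ 0
  trunc≡n∧n<p^i⇒digit≡0 refl n<pⁱ i<k = m*n<n⇒m≡0 (ℕₚ.≤-<-trans (digit*p^i≤trunc i<k) n<pⁱ)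

  congruent⇒zero-block : ∀ {k m n} → PowDividesDiff p d k n → n < p ^ m →
    ∀ i → i < k ∸ m → toℕ (d (m ℕ.+ i)) ≡ 0
  congruent⇒zero-block {k} {m} {n} pᵏ∣n-ζ n<pᵐ i i<k∸m =
    trunc≡n∧n<p^i⇒digit≡0 trunc≡n (ℕₚ.<-≤-trans n<pᵐ (ℕₚ.^-monoʳ-≤ p (ℕₚ.m≤m+n m i))) m+i<k
    where
    m≤k : m ≤ k
    m≤k = ℕₚ.<⇒≤ (ℕₚ.m∸n≢0⇒n<m (ℕₚ.m<n⇒n≢0 i<k∸m))
    m+i<k : m ℕ.+ i < k
    m+i<k = subst (m ℕ.+ i <_) (ℕₚ.m+[n∸m]≡n m≤k) (ℕₚ.+-monoʳ-< m i<k∸m)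
    trunc≡n : trunc p d k ≡ n
    trunc≡n = sym (P∣m-n∧m<P∧n<P⇒m≡n pᵏ∣n-ζ (ℕₚ.<-≤-trans n<pᵐ (ℕₚ.^-monoʳ-≤ p m≤k)) (trunc-< k))

  congruent⇒k≤[2C+D+2]e : ∀ C D → - (C + 1ℚ) ≤ℚ D →
    (∀ a → 2 ≤ a → ZeroBlockLenLe p d a (C * ℚ[ a ] + D)) →
    ∀ {k n e} → 1 ≤ e → n < p ^ suc e → PowDividesDiff p d k n →
    ℚ[ k ] ≤ℚ (ℚ[ 2 ] * C + D + ℚ[ 2 ]) * ℚ[ e ]
  congruent⇒k≤[2C+D+2]e C D -[C+1]≤D ℓ≤Ca+D {k} {n} {e} 1≤e n<pᵉ⁺¹ pᵏ∣n-ζ = begin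
    ℚ[ k ]                           ≤⟨ ℚ[]-mono-≤ (ℕₚ.m≤n+m∸n k (suc e)) ⟩
    ℚ[ suc e ℕ.+ (k ∸ suc e) ]      ≡⟨ ℚ[]-homo-+ (suc e) (k ∸ suc e) ⟩
    ℚ[ suc e ] + ℚ[ k ∸ suc e ]     ≡⟨ cong (_+ ℚ[ k ∸ suc e ]) ℚ[1+e] ⟩
    (1ℚ + ℚ[ e ]) + ℚ[ k ∸ suc e ]  ≤⟨ ℓ≤C[1+e]+D⇒1+e+ℓ≤[2C+D+2]e C D (ℚ[]-mono-≤ 1≤e) -[C+1]≤D block ⟩
    (ℚ[ 2 ] * C + D + ℚ[ 2 ]) * ℚ[ e ] ∎
    where
    open ℚₚ.≤-Reasoning
    ℚ[1+e] : ℚ[ suc e ] ≡ 1ℚ + ℚ[ e ]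
    ℚ[1+e] = ℚ[]-homo-+ 1 e
    block : ℚ[ k ∸ suc e ] ≤ℚ C * (1ℚ + ℚ[ e ]) + D
    block = subst (λ x → ℚ[ k ∸ suc e ] ≤ℚ C * x + D) ℚ[1+e]
      (ℓ≤Ca+D (suc e) (s≤s 1≤e) (k ∸ suc e) (congruent⇒zero-block {k} pᵏ∣n-ζ n<pᵉ⁺¹))

proposition6p2 : (p : ℕ) → Prime p → (d : Digits p) → ¬ InNat p d →
    (C D : ℚ) → 0ℚ <ℚ C → - (C + 1ℚ) ≤ℚ D →
    (∀ a → 2 ≤ a → ZeroBlockLenLe p d a (C * ℚ[ a ] + D)) →
    ∀ n → p ≤ n → ∀ k → PowDividesDiff p d k n →
    LogBound p k n (ℚ[ 2 ] * C + D + ℚ[ 2 ])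
proposition6p2 p p-prime d _ C D _ -[C+1]≤D ℓ≤Ca+D n p≤n k pᵏ∣n-ζ =
  let e , pᵉ≤n , n<pᵉ⁺¹ = ∃-p^e≤n<p^[1+e] 1<p n 0<n
  in LogBound-intro {p} {k} {n} {e} (ℚ[ 2 ] * C + D + ℚ[ 2 ]) pᵉ≤n
       (congruent⇒k≤[2C+D+2]e d C D -[C+1]≤D ℓ≤Ca+D {k} {n} {e}
         (p≤n<p^[1+e]⇒1≤e {p} p≤n n<pᵉ⁺¹) n<pᵉ⁺¹ pᵏ∣n-ζ)
  where
  instance
    p≢0 : NonZero p
    p≢0 = prime⇒nonZero p-prime
  1<p : 1 < p
  1<p = ℕ.nonTrivial⇒n>1 p {{prime⇒nonTrivial p-prime}}
  0<n : 0 < n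
  0<n = ℕₚ.<-≤-trans (ℕₚ.<-trans (s≤s z≤n) 1<p) p≤n
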